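{- Let $G=(V,E)$ be a finite, connected, undirected, unweighted graph and let $d(x,y)$ denote the shortest-path distance between $x,y\in V$. Let $t\in V$ be a target vertex and let $l_1,l_2\in V$ be landmark vertices. For $v\in V$ define $\pi_t^{DL}(v,1)=|d(v,l_1)-d(l_1,l_2)|-d(l_2,t)$, $\pi_t^{DL}(v,2)=|d(v,l_1)-d(l_2,t)|-d(l_1,l_2)$, $\pi_t^{DL}(v,3)=|d(l_1,l_2)-d(l_2,t)|-d(v,l_1)$, $\pi_t^{DL}(v,4)=|d(v,l_1)-d(l_1,t)|$, $\pi_t^{DL}(v,5)=|d(v,l_2)-d(l_2,t)|$, and, when $l_1\neq l_2$, $\pi_t^{DL}(v,6)=\dfrac{|d(v,l_1)-d(l_1,l_2)|\cdot|d(l_1,l_2)-d(l_2,t)|-d(v,l_1)\cdot d(l_2,t)}{d(l_1,l_2)}$, and let $\pi_t^{DL}(v)=\max_i \pi_t^{DL}(v,i)$, the maximum taken over those $i\in\{1,\dots,6\}$ for which $\pi_t^{DL}(v,i)$ is defined. Then $\pi_t^{DL}$ is an admissible heuristic for A*: for every $v\in V$, $\pi_t^{DL}(v)\le d(v,t)$.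
   Context: A heuristic $h$ for A* search toward target $t$ is admissible if it never overestimates the remaining distance, i.e. $h(v)\le d(v,t)$ for all vertices $v$. The function $\pi_t^{DL}$ is called the dual landmark heuristic. -}

module Defs where

open import Data.Nat using (ℕ; zero; suc; _≤_)
open import Data.Fin using (Fin; _≟_)
open import Data.Integer as ℤ using (ℤ; +_; ∣_∣)
open import Data.Rational as ℚ using (ℚ; _/_; _⊔_)
open import Data.Product using (Σ; ∃; _×_)
open import Relation.Nullary using (¬_; yes; no)
open import Relation.Binary.PropositionalEquality using (_≡_)

data Walk {n : ℕ} (Adj : Fin n → Fin n → Set) : Fin n → Fin n → ℕ → Set where
  nil  : ∀ {x} → Walk Adj x x 0
  cons : ∀ {x y z k} → Adj x y → Walk Adj y z k → Walk Adj x z (suc k)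

record SimpleGraph (n : ℕ) (Adj : Fin n → Fin n → Set) : Set where
  field
    sym   : ∀ {x y} → Adj x y → Adj y x
    irrefl : ∀ {x} → ¬ Adj x x

Connected : {n : ℕ} → (Fin n → Fin n → Set) → Set
Connected {n} Adj = ∀ (x y : Fin n) → ∃ λ k → Walk Adj x y k

IsShortestPathDistance : {n : ℕ} → (Fin n → Fin n → Set) → (Fin n → Fin n → ℕ) → Set
IsShortestPathDistance {n} Adj d =
  ∀ (x y : Fin n) → Walk Adj x y (d x y) × (∀ k → Walk Adj x y k → d x y ≤ k)

I : ℕ → ℤ
I m = + m

absDiff : ℤ → ℤ → ℤ
absDiff a b = + ∣ a ℤ.- b ∣

toℚ : ℤ → ℚ
toℚ z = z / 1

module _ {n : ℕ} (d : Fin n → Fin n → ℕ) (t l₁ l₂ : Fin n) where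

  π₁ π₂ π₃ π₄ π₅ : Fin n → ℤ
  π₁ v = absDiff (I (d v l₁)) (I (d l₁ l₂)) ℤ.- I (d l₂ t)
  π₂ v = absDiff (I (d v l₁)) (I (d l₂ t)) ℤ.- I (d l₁ l₂)
  π₃ v = absDiff (I (d l₁ l₂)) (I (d l₂ t)) ℤ.- I (d v l₁)
  π₄ v = absDiff (I (d v l₁)) (I (d l₁ t))
  π₅ v = absDiff (I (d v l₂)) (I (d l₂ t))

  π₆num : Fin n → ℤ
  π₆num v = absDiff (I (d v l₁)) (I (d l₁ l₂)) ℤ.* absDiff (I (d l₁ l₂)) (I (d l₂ t))
            ℤ.- I (d v l₁) ℤ.* I (d l₂ t)

  max₅ : Fin n → ℚ
  max₅ v = toℚ (π₁ v) ⊔ (toℚ (π₂ v) ⊔ (toℚ (π₃ v) ⊔ (toℚ (π₄ v) ⊔ toℚ (π₅ v))))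

  -- π(v,6) is included exactly when l₁ ≢ l₂. (For a genuine distance d,
  -- l₁ ≢ l₂ forces d l₁ l₂ = suc k, so the inner 'zero' branch is unreachable.)
  πDL : Fin n → ℚ
  πDL v with l₁ ≟ l₂
  ... | yes _ = max₅ v
  ... | no _ with d l₁ l₂
  ...   | zero  = max₅ v
  ...   | suc k = max₅ v ⊔ (π₆num v / suc k)

-- Shortest-path distance is symmetric and satisfies the triangle inequality, since walks can be
-- reversed and concatenated. The bounds π(v,1) … π(v,5) ≤ d(v,t) are then reverse triangle
-- inequalities in the quadrilateral v l₁ l₂ t. For π(v,6) write a = d(v,l₁), b = d(l₁,l₂),
-- c = d(l₂,t), D = d(v,t); the claim is |a − b|·|b − c| ≤ a c + D b, which follows from the
-- π(v,1) and π(v,3) bounds |a − b| ≤ c + D and |b − c| ≤ a + D by cases on where b lies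
-- relative to a and c.
module Submission where

open import Data.Fin using (Fin; _≟_)
open import Data.Nat.Base as ℕ using (ℕ; zero; suc; _+_; _*_; ∣_-_∣)
import Data.Integer.Base as ℤ
open import Data.Product using (proj₁; proj₂)
open import Data.Sum using (inj₁; inj₂)
open import Function.Metric.Nat.Definitions using (Symmetric; TriangleInequality)
open import Relation.Binary.PropositionalEquality
open import Relation.Nullary using (yes; no)

open import Defs

module _ {n : ℕ} {Adj : Fin n → Fin n → Set} where

  _++ᵂ_ : ∀ {x y z k m} → Walk Adj x y k → Walk Adj y z m → Walk Adj x z (k + m)
  nil      ++ᵂ w′ = w′
  cons e w ++ᵂ w′ = cons e (w ++ᵂ w′)

  snocᵂ : ∀ {x y z k} → Walk Adj x y k → Adj y z → Walk Adj x z (suc k)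
  snocᵂ nil         e = cons e nil
  snocᵂ (cons e′ w) e = cons e′ (snocᵂ w e)

  reverseᵂ : (∀ {x y} → Adj x y → Adj y x) → ∀ {x y k} → Walk Adj x y k → Walk Adj y x k
  reverseᵂ Adj-sym nil        = nil
  reverseᵂ Adj-sym (cons e w) = snocᵂ (reverseᵂ Adj-sym w) (Adj-sym e)

module ShortestPath {n : ℕ} {Adj : Fin n → Fin n → Set} (Adj-sym : ∀ {x y} → Adj x y → Adj y x)
                    {d : Fin n → Fin n → ℕ} (d-shortest : IsShortestPathDistance Adj d) where

  open import Data.Nat.Base using (_≤_)
  open import Data.Nat.Properties using (≤-antisym)

  private
    geodesic : ∀ x y → Walk Adj x y (d x y)
    geodesic x y = proj₁ (d-shortest x y)

    d-minimal : ∀ {x y k} → Walk Adj x y k → d x y ≤ k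
    d-minimal w = proj₂ (d-shortest _ _) _ w

  d-sym : Symmetric d
  d-sym x y = ≤-antisym (d-minimal (reverseᵂ Adj-sym (geodesic y x)))
                        (d-minimal (reverseᵂ Adj-sym (geodesic x y)))

  d-triangle : TriangleInequality d
  d-triangle x y z = d-minimal (geodesic x y ++ᵂ geodesic y z)

module NatDistance where

  open import Data.Nat.Base using (_≤_)
  open import Data.Nat.Properties
  open import Data.List.Base using (_∷_; [])
  open import Data.Nat.Tactic.RingSolver using (solve)
  open ≤-Reasoning

  m≤n+o∧n≤m+o⇒∣m-n∣≤o : ∀ {m n o} → m ≤ n + o → n ≤ m + o → ∣ m - n ∣ ≤ o
  m≤n+o∧n≤m+o⇒∣m-n∣≤o {m} {n} m≤n+o n≤m+o with ∣m-n∣≡[m∸n]∨[n∸m] m n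
  ... | inj₁ ∣m-n∣≡m∸n = ≤-trans (≤-reflexive ∣m-n∣≡m∸n) (m≤n+o⇒m∸n≤o m n m≤n+o)
  ... | inj₂ ∣m-n∣≡n∸m = ≤-trans (≤-reflexive ∣m-n∣≡n∸m) (m≤n+o⇒m∸n≤o n m n≤m+o)

  m≤o∧n≤o⇒∣m-n∣≤o : ∀ {m n o} → m ≤ o → n ≤ o → ∣ m - n ∣ ≤ o
  m≤o∧n≤o⇒∣m-n∣≤o {m} {n} m≤o n≤o = ≤-trans (∣m-n∣≤m⊔n m n) (⊔-lub m≤o n≤o)

  m≤n⇒m+∣m-n∣≡n : ∀ {m n} → m ≤ n → m + ∣ m - n ∣ ≡ n
  m≤n⇒m+∣m-n∣≡n {m} m≤n = trans (cong (m +_) (m≤n⇒∣m-n∣≡n∸m m≤n)) (m+[n∸m]≡n m≤n)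

  -- From b = a + p = c + q one gets p q + b c = a c + b p, so the bound reduces to p ≤ c + D.
  p*q≤a*c+D*b : ∀ {a b c D p q} → a + p ≡ b → c + q ≡ b → p ≤ c + D → p * q ≤ a * c + D * b
  p*q≤a*c+D*b {a} {_} {c} {D} {p} {q} refl c+q≡b p≤c+D = +-cancelʳ-≤ ((a + p) * c) (p * q) _ (begin
    p * q + (a + p) * c          ≡⟨ solve (a ∷ c ∷ p ∷ q ∷ []) ⟩
    a * c + (c + q) * p          ≡⟨ cong (λ b → a * c + b * p) c+q≡b ⟩
    a * c + (a + p) * p          ≤⟨ +-monoʳ-≤ (a * c) (*-monoʳ-≤ (a + p) p≤c+D) ⟩
    a * c + (a + p) * (c + D)    ≡⟨ solve (a ∷ c ∷ D ∷ p ∷ []) ⟩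
    a * c + D * (a + p) + (a + p) * c ∎)

  ∣a-b∣*∣b-c∣≤a*c+D*b : ∀ a b c D → ∣ a - b ∣ ≤ c + D → ∣ b - c ∣ ≤ a + D →
                        ∣ a - b ∣ * ∣ b - c ∣ ≤ a * c + D * b
  ∣a-b∣*∣b-c∣≤a*c+D*b a b c D ∣a-b∣≤c+D ∣b-c∣≤a+D with ≤-total a b | ≤-total b c
  ... | inj₂ b≤a | inj₁ b≤c = begin
    ∣ a - b ∣ * ∣ b - c ∣  ≤⟨ *-mono-≤ (m≤o∧n≤o⇒∣m-n∣≤o ≤-refl b≤a) (m≤o∧n≤o⇒∣m-n∣≤o b≤c ≤-refl) ⟩
    a * c                  ≤⟨ m≤m+n (a * c) (D * b) ⟩
    a * c + D * b          ∎
  ... | inj₂ b≤a | inj₂ c≤b = begin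
    ∣ a - b ∣ * ∣ b - c ∣  ≤⟨ *-mono-≤ ∣a-b∣≤c+D (m≤o∧n≤o⇒∣m-n∣≤o ≤-refl c≤b) ⟩
    (c + D) * b            ≡⟨ *-distribʳ-+ b c D ⟩
    c * b + D * b          ≤⟨ +-monoˡ-≤ (D * b) (*-monoʳ-≤ c b≤a) ⟩
    c * a + D * b          ≡⟨ cong (_+ D * b) (*-comm c a) ⟩
    a * c + D * b          ∎
  ... | inj₁ a≤b | inj₁ b≤c = begin
    ∣ a - b ∣ * ∣ b - c ∣  ≤⟨ *-mono-≤ (m≤o∧n≤o⇒∣m-n∣≤o a≤b ≤-refl) ∣b-c∣≤a+D ⟩
    b * (a + D)            ≡⟨ *-distribˡ-+ b a D ⟩
    b * a + b * D          ≡⟨ cong₂ _+_ (*-comm b a) (*-comm b D) ⟩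
    a * b + D * b          ≤⟨ +-monoˡ-≤ (D * b) (*-monoʳ-≤ a b≤c) ⟩
    a * c + D * b          ∎
  ... | inj₁ a≤b | inj₂ c≤b =
    p*q≤a*c+D*b (m≤n⇒m+∣m-n∣≡n a≤b)
                (trans (cong (c +_) (∣-∣-comm b c)) (m≤n⇒m+∣m-n∣≡n c≤b)) ∣a-b∣≤c+D

module Metric {A : Set} {d : A → A → ℕ} (d-sym : Symmetric d) (d-triangle : TriangleInequality d) where

  open import Data.Nat.Base using (_≤_)
  open import Data.Nat.Properties using (≤-trans; +-comm; +-mono-≤; ∣-∣-triangle; module ≤-Reasoning)
  open NatDistance using (m≤n+o∧n≤m+o⇒∣m-n∣≤o)
  open ≤-Reasoning

  reverse-triangle : ∀ x y z → ∣ d x y - d y z ∣ ≤ d x z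
  reverse-triangle x y z = m≤n+o∧n≤m+o⇒∣m-n∣≤o xy≤yz+xz yz≤xy+xz
    where
    xy≤yz+xz : d x y ≤ d y z + d x z
    xy≤yz+xz = begin
      d x y          ≤⟨ d-triangle x z y ⟩
      d x z + d z y  ≡⟨ cong (d x z +_) (d-sym z y) ⟩
      d x z + d y z  ≡⟨ +-comm (d x z) (d y z) ⟩
      d y z + d x z  ∎
    yz≤xy+xz : d y z ≤ d x y + d x z
    yz≤xy+xz = begin
      d y z          ≤⟨ d-triangle y x z ⟩
      d y x + d x z  ≡⟨ cong (_+ d x z) (d-sym y x) ⟩
      d x y + d x z  ∎

  ∣wx-xy∣≤yz+wz : ∀ w x y z → ∣ d w x - d x y ∣ ≤ d y z + d w z
  ∣wx-xy∣≤yz+wz w x y z = begin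
    ∣ d w x - d x y ∣  ≤⟨ reverse-triangle w x y ⟩
    d w y              ≤⟨ d-triangle w z y ⟩
    d w z + d z y      ≡⟨ cong (d w z +_) (d-sym z y) ⟩
    d w z + d y z      ≡⟨ +-comm (d w z) (d y z) ⟩
    d y z + d w z      ∎

  ∣wx-yz∣≤xy+wz : ∀ w x y z → ∣ d w x - d y z ∣ ≤ d x y + d w z
  ∣wx-yz∣≤xy+wz w x y z = begin
    ∣ d w x - d y z ∣                      ≤⟨ ∣-∣-triangle (d w x) (d w y) (d y z) ⟩
    ∣ d w x - d w y ∣ + ∣ d w y - d y z ∣  ≤⟨ +-mono-≤ ∣wx-wy∣≤xy (reverse-triangle w y z) ⟩
    d x y + d w z                          ∎
    where
    ∣wx-wy∣≤xy : ∣ d w x - d w y ∣ ≤ d x y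
    ∣wx-wy∣≤xy = subst (λ e → ∣ e - d w y ∣ ≤ d x y) (d-sym x w) (reverse-triangle x w y)

  ∣xy-yz∣≤wx+wz : ∀ w x y z → ∣ d x y - d y z ∣ ≤ d w x + d w z
  ∣xy-yz∣≤wx+wz w x y z = begin
    ∣ d x y - d y z ∣  ≤⟨ reverse-triangle x y z ⟩
    d x z              ≤⟨ d-triangle x w z ⟩
    d x w + d w z      ≡⟨ cong (_+ d w z) (d-sym x w) ⟩
    d w x + d w z      ∎

module IntegerBounds where

  open import Data.Integer.Base using (+_; _≤_; _-_; +≤+; _⊖_)
  open import Data.Integer.Properties
    using (∣⊖∣-≤; ∣m⊖n∣≡∣n⊖m∣; [+m]-[+n]≡m⊖n; ⊖-monoˡ-≤; ⊖-≥; pos-*; module ≤-Reasoning)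
  open import Data.Nat.Properties using (≤-total; m≤n⇒∣m-n∣≡n∸m; m≤n⇒∣n-m∣≡n∸m; m≤m+n; m+n∸m≡n)
  open ≤-Reasoning

  ∣m⊖n∣≡∣m-n∣ : ∀ m n → ℤ.∣ m ⊖ n ∣ ≡ ∣ m - n ∣
  ∣m⊖n∣≡∣m-n∣ m n with ≤-total m n
  ... | inj₁ m≤n = trans (∣⊖∣-≤ m≤n) (sym (m≤n⇒∣m-n∣≡n∸m m≤n))
  ... | inj₂ n≤m = trans (∣m⊖n∣≡∣n⊖m∣ m n) (trans (∣⊖∣-≤ n≤m) (sym (m≤n⇒∣n-m∣≡n∸m n≤m)))

  absDiff-+ : ∀ m n → absDiff (+ m) (+ n) ≡ + ∣ m - n ∣
  absDiff-+ m n = cong ℤ.+_ (trans (cong ℤ.∣_∣ ([+m]-[+n]≡m⊖n m n)) (∣m⊖n∣≡∣m-n∣ m n))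

  m≤n+o⇒+m-+n≤+o : ∀ {m n o} → m ℕ.≤ n + o → + m - + n ≤ + o
  m≤n+o⇒+m-+n≤+o {m} {n} {o} m≤n+o = begin
    + m - + n        ≡⟨ [+m]-[+n]≡m⊖n m n ⟩
    m ⊖ n            ≤⟨ ⊖-monoˡ-≤ n m≤n+o ⟩
    (n + o) ⊖ n      ≡⟨ ⊖-≥ (m≤m+n n o) ⟩
    + (n + o ℕ.∸ n)  ≡⟨ cong ℤ.+_ (m+n∸m≡n n o) ⟩
    + o              ∎

  absDiff-≤ : ∀ x y {w} → ∣ x - y ∣ ℕ.≤ w → absDiff (+ x) (+ y) ≤ + w
  absDiff-≤ x y ∣x-y∣≤w rewrite absDiff-+ x y = +≤+ ∣x-y∣≤w

  absDiff-minus-≤ : ∀ x y z {w} → ∣ x - y ∣ ℕ.≤ z + w → absDiff (+ x) (+ y) - + z ≤ + w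
  absDiff-minus-≤ x y z ∣x-y∣≤z+w rewrite absDiff-+ x y = m≤n+o⇒+m-+n≤+o ∣x-y∣≤z+w

  absDiff*absDiff-minus-≤ : ∀ a b c D → ∣ a - b ∣ * ∣ b - c ∣ ℕ.≤ a * c + D * b →
                            absDiff (+ a) (+ b) ℤ.* absDiff (+ b) (+ c) - + a ℤ.* + c ≤ + D ℤ.* + b
  absDiff*absDiff-minus-≤ a b c D bound =
    subst₂ _≤_ (sym lhs≡) (pos-* D b) (m≤n+o⇒+m-+n≤+o bound)
    where
    lhs≡ : absDiff (+ a) (+ b) ℤ.* absDiff (+ b) (+ c) - + a ℤ.* + c
         ≡ + (∣ a - b ∣ * ∣ b - c ∣) - + (a * c)
    lhs≡ = cong₂ _-_ (trans (cong₂ ℤ._*_ (absDiff-+ a b) (absDiff-+ b c)) (sym (pos-* ∣ a - b ∣ ∣ b - c ∣)))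
                     (sym (pos-* a c))

open import Data.Rational using (_≤_)
open import Data.Rational.Base using (_/_; fromℚᵘ)
open import Data.Rational.Properties using (toℚᵘ-cancel-≤; toℚᵘ-fromℚᵘ; ⊔-lub)
import Data.Rational.Unnormalised.Base as ℚᵘ
import Data.Rational.Unnormalised.Properties as ℚᵘ
import Data.Integer.Properties as ℤ

fromℚᵘ-mono-≤ : ∀ {p q} → p ℚᵘ.≤ q → fromℚᵘ p ≤ fromℚᵘ q
fromℚᵘ-mono-≤ {p} {q} p≤q = toℚᵘ-cancel-≤
  (ℚᵘ.≤-respˡ-≃ (ℚᵘ.≃-sym (toℚᵘ-fromℚᵘ p)) (ℚᵘ.≤-respʳ-≃ (ℚᵘ.≃-sym (toℚᵘ-fromℚᵘ q)) p≤q))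

-- i / suc k and toℚ j are, by definition, fromℚᵘ (mkℚᵘ i k) and fromℚᵘ (mkℚᵘ j 0).
i≤j*[1+k]⇒i/[1+k]≤toℚj : ∀ {i j} k → i ℤ.≤ j ℤ.* ℤ.+ suc k → i / suc k ≤ toℚ j
i≤j*[1+k]⇒i/[1+k]≤toℚj {i} {j} k i≤j*[1+k] = fromℚᵘ-mono-≤ {ℚᵘ.mkℚᵘ i k} {ℚᵘ.mkℚᵘ j 0}
  (ℚᵘ.*≤* (subst (ℤ._≤ _) (sym (ℤ.*-identityʳ i)) i≤j*[1+k]))

toℚ-mono-≤ : ∀ {i j} → i ℤ.≤ j → toℚ i ≤ toℚ j
toℚ-mono-≤ {i} {j} i≤j = i≤j*[1+k]⇒i/[1+k]≤toℚj {i} {j} 0 (subst (i ℤ.≤_) (sym (ℤ.*-identityʳ j)) i≤j)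

module DualLandmark {n : ℕ} {d : Fin n → Fin n → ℕ} (d-sym : Symmetric d) (d-triangle : TriangleInequality d)
                    (t l₁ l₂ v : Fin n) where

  open Metric d-sym d-triangle
  open NatDistance using (∣a-b∣*∣b-c∣≤a*c+D*b)
  open IntegerBounds

  π₁-admissible : π₁ d t l₁ l₂ v ℤ.≤ I (d v t)
  π₁-admissible = absDiff-minus-≤ (d v l₁) (d l₁ l₂) (d l₂ t) (∣wx-xy∣≤yz+wz v l₁ l₂ t)

  π₂-admissible : π₂ d t l₁ l₂ v ℤ.≤ I (d v t)
  π₂-admissible = absDiff-minus-≤ (d v l₁) (d l₂ t) (d l₁ l₂) (∣wx-yz∣≤xy+wz v l₁ l₂ t)

  π₃-admissible : π₃ d t l₁ l₂ v ℤ.≤ I (d v t)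
  π₃-admissible = absDiff-minus-≤ (d l₁ l₂) (d l₂ t) (d v l₁) (∣xy-yz∣≤wx+wz v l₁ l₂ t)

  π₄-admissible : π₄ d t l₁ l₂ v ℤ.≤ I (d v t)
  π₄-admissible = absDiff-≤ (d v l₁) (d l₁ t) (reverse-triangle v l₁ t)

  π₅-admissible : π₅ d t l₁ l₂ v ℤ.≤ I (d v t)
  π₅-admissible = absDiff-≤ (d v l₂) (d l₂ t) (reverse-triangle v l₂ t)

  max₅-admissible : max₅ d t l₁ l₂ v ≤ toℚ (I (d v t))
  max₅-admissible =
    ⊔-lub (toℚ-mono-≤ π₁-admissible) (⊔-lub (toℚ-mono-≤ π₂-admissible) (⊔-lub (toℚ-mono-≤ π₃-admissible)
          (⊔-lub (toℚ-mono-≤ π₄-admissible) (toℚ-mono-≤ π₅-admissible))))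

  π₆num-admissible : π₆num d t l₁ l₂ v ℤ.≤ I (d v t) ℤ.* I (d l₁ l₂)
  π₆num-admissible = absDiff*absDiff-minus-≤ a b c D
    (∣a-b∣*∣b-c∣≤a*c+D*b a b c D (∣wx-xy∣≤yz+wz v l₁ l₂ t) (∣xy-yz∣≤wx+wz v l₁ l₂ t))
    where
    a b c D : ℕ
    a = d v l₁
    b = d l₁ l₂
    c = d l₂ t
    D = d v t

  πDL-admissible : πDL d t l₁ l₂ v ≤ toℚ (I (d v t))
  πDL-admissible with l₁ ≟ l₂
  ... | yes _ = max₅-admissible
  ... | no _ with d l₁ l₂ in d[l₁,l₂]≡b
  ...   | zero  = max₅-admissible
  ...   | suc k = ⊔-lub max₅-admissible
                    (i≤j*[1+k]⇒i/[1+k]≤toℚj {j = I (d v t)} k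
                      (subst (λ b → π₆num d t l₁ l₂ v ℤ.≤ I (d v t) ℤ.* I b) d[l₁,l₂]≡b π₆num-admissible))

theorem1 : (n : ℕ) (Adj : Fin n → Fin n → Set) → SimpleGraph n Adj → Connected Adj →
           (d : Fin n → Fin n → ℕ) → IsShortestPathDistance Adj d →
           (t l₁ l₂ v : Fin n) → πDL d t l₁ l₂ v ≤ toℚ (I (d v t))
theorem1 _ _ G _ _ d-shortest = DualLandmark.πDL-admissible d-sym d-triangle
  where open ShortestPath (SimpleGraph.sym G) d-shortest
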